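{- Let $n\ge2$ and let $W=T(M)\rtimes W_0$ be the affine Weyl group of type $C_n^{(1)}$ acting on $\mathfrak h^*$ as in the context. For every $w=t_q\overline w\in W$ (with $q\in M$, $\overline w\in W_0$) we have $\mathcal L_{\Lambda_0}(\sigma_n w)=\mathcal L_{\Lambda_0}(w)$.
   Context: Fix $n\ge2$, $h=2n$. $V_0=\mathbb R^n$ with standard inner product $(\cdot|\cdot)$, $|x|^2=(x|x)$, standard basis $\varepsilon_1,\dots,\varepsilon_n$. Simple roots $\alpha_i=\frac1{\sqrt2}(\varepsilon_i-\varepsilon_{i+1})$ ($1\le i\le n-1$), $\alpha_n=\sqrt2\varepsilon_n$, $\theta=2\alpha_1+\dots+2\alpha_{n-1}+\alpha_n$. Let $\mathfrak h^*=V_0\oplus\mathbb R\delta\oplus\mathbb R\Lambda_0$ and $\alpha_0:=\delta-\theta$. The height $\mathrm{ht}$ is the linear form on $V_0\oplus\mathbb R\delta$ with $\mathrm{ht}(\alpha_i)=1$ for $0\le i\le n$ (so $\mathrm{ht}(\delta)=2n$). $\langle\cdot,c\rangle$ is the linear form on $\mathfrak h^*$ vanishing on $V_0\oplus\mathbb R\delta$ with $\langle\Lambda_0,c\rangle=1$, and $(v|x)$ for $v\in\mathfrak h^*$, $x\in V_0$ is extended by $(\delta|x)=(\Lambda_0|x)=0$. For $x\in V_0$, $t_x(v)=v+\langle v,c\rangle x-\big((v|x)+\tfrac12|x|^2\langle v,c\rangle\big)\delta$. $W_0$ is the group of signed permutations of coordinates of $V_0$ (Weyl group of type $C_n$, generated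 by the reflections $s_1,\dots,s_n$ in $\alpha_1,\dots,\alpha_n$), fixing $\delta$ and $\Lambda_0$. $M=\sqrt2\mathbb Z^n$ and $W=T(M)\rtimes W_0$. $\omega_n=\frac{\sqrt2}{2}(\varepsilon_1+\dots+\varepsilon_n)$. The $\Lambda_0$-atomic length of $g$ (with $\Lambda_0-g\Lambda_0\in V_0\oplus\mathbb R\delta$) is $\mathcal L_{\Lambda_0}(g)=\mathrm{ht}(\Lambda_0-g\Lambda_0)$. $w_0=-\mathrm{id}$ is the longest element of $W_0$, $w_{0,n}$ is the longest element of $\langle s_1,\dots,s_{n-1}\rangle\cong S_n$ (the reversal $(x_1,\dots,x_n)\mapsto(x_n,\dots,x_1)$), and $\sigma_n:=t_{\omega_n}w_{0,n}w_0$. -}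

module Defs where

open import Data.Nat using (ℕ; zero; suc; _∸_) renaming (_*_ to _*ℕ_)
open import Data.Fin using (Fin; zero; suc; toℕ; opposite)
open import Data.Fin.Permutation using (Permutation′; _⟨$⟩ʳ_)
open import Data.Bool using (Bool; true; false)
open import Data.Integer using (ℤ; +_)
open import Data.Rational using (ℚ; _+_; _*_; _-_; -_; _/_; 0ℚ; 1ℚ; ½)

-- Everything in the statement (simple roots, Λ₀, δ,
-- the lattice M, ω_n and the action of W and of σ_n) lives in the
-- Q-span of α₀,…,αₙ,Λ₀.  Its V₀-part is √2·ℚⁿ ⊂ ℝⁿ.
-- CONVENTION: a vector  a : Fin n → ℚ  represents the element
--   x = √2 · (a₁ ε₁ + … + aₙ εₙ)  of V₀ = ℝⁿ.
-- In these coordinates: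
--   αᵢ = ½(eᵢ - eᵢ₊₁)  (1 ≤ i ≤ n-1),  αₙ = eₙ,  θ = e₁,
--   M = √2 ℤⁿ  corresponds to  ℤⁿ,   ωₙ corresponds to (½,…,½),
--   (x | y) = 2 · Σ aⱼ bⱼ.

V₀ : ℕ → Set
V₀ n = Fin n → ℚ

∑ : ∀ {n} → (Fin n → ℚ) → ℚ
∑ {zero}  f = 0ℚ
∑ {suc n} f = f zero + ∑ (λ i → f (suc i))

fromℕ : ℕ → ℚ
fromℕ k = + k / 1

⟪_∣_⟫ : ∀ {n} → V₀ n → V₀ n → ℚ
⟪ a ∣ b ⟫ = fromℕ 2 * ∑ (λ j → a j * b j)

∥_∥² : ∀ {n} → V₀ n → ℚ
∥ a ∥² = ⟪ a ∣ a ⟫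

_⊕_ : ∀ {n} → V₀ n → V₀ n → V₀ n
(a ⊕ b) j = a j + b j

_⊙_ : ∀ {n} → ℚ → V₀ n → V₀ n
(c ⊙ a) j = c * a j

-- Elements of h* = V₀ ⊕ ℚδ ⊕ ℚΛ₀
record H* (n : ℕ) : Set where
  constructor ⟨_,_,_⟩
  field
    fin : V₀ n
    dlt : ℚ
    lam : ℚ      -- coefficient of Λ₀ ( = ⟨v , c⟩ )
open H* public

Λ₀ : ∀ {n} → H* n
Λ₀ = ⟨ (λ _ → 0ℚ) , 0ℚ , 1ℚ ⟩

_⊖_ : ∀ {n} → H* n → H* n → H* n
u ⊖ v = ⟨ (λ j → fin u j - fin v j) , dlt u - dlt v , lam u - lam v ⟩

-- the height: linear form on V₀ ⊕ ℚδ with ht(αᵢ) = 1 (0 ≤ i ≤ n), ht δ = 2n.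
-- In √2-coordinates ht(x) = Σⱼ (2n - 2j + 1) aⱼ  (j = 1..n, here j = toℕ i + 1).
htV₀ : ∀ {n} → V₀ n → ℚ
htV₀ {n} a = ∑ (λ i → fromℕ ((2 *ℕ (n ∸ toℕ i)) ∸ 1) * a i)

ht : ∀ {n} → H* n → ℚ       -- only applied to elements with zero Λ₀-part
ht {n} v = htV₀ (fin v) + fromℕ (2 *ℕ n) * dlt v

t : ∀ {n} → V₀ n → H* n → H* n
t x v = ⟨ fin v ⊕ (lam v ⊙ x)
        , dlt v - (⟪ fin v ∣ x ⟫ + (½ * ∥ x ∥²) * lam v)
        , lam v ⟩

lift : ∀ {n} → (V₀ n → V₀ n) → H* n → H* n
lift f v = ⟨ f (fin v) , dlt v , lam v ⟩

-- Signed permutations (= W₀ of type Cₙ): a permutation π and signs s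
-- (true = +1, false = -1), acting by  (w a)ᵢ = sᵢ · a_{π(i)}.
record SignedPerm (n : ℕ) : Set where
  constructor sp
  field
    perm : Permutation′ n
    sgn  : Fin n → Bool
open SignedPerm public

sign : Bool → ℚ → ℚ
sign true  q = q
sign false q = - q

actW₀ : ∀ {n} → SignedPerm n → V₀ n → V₀ n
actW₀ w a i = sign (sgn w i) (a (perm w ⟨$⟩ʳ i))

elt : ∀ {n} → V₀ n → SignedPerm n → H* n → H* n
elt q w v = t q (lift (actW₀ w) v)

embM : ∀ {n} → (Fin n → ℤ) → V₀ n
embM q j = q j / 1

w₀ : ∀ {n} → V₀ n → V₀ n
w₀ a j = - a j

w₀ₙ : ∀ {n} → V₀ n → V₀ n
w₀ₙ a j = a (opposite j)

ωₙ : ∀ {n} → V₀ n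
ωₙ _ = ½

σₙ : ∀ {n} → H* n → H* n
σₙ v = t ωₙ (lift w₀ₙ (lift w₀ v))

L : ∀ {n} → (H* n → H* n) → ℚ
L g = ht (Λ₀ ⊖ g Λ₀)

-- The height is linear and ignores the Λ₀-coefficient, so it suffices that ht ∘ σₙ = ht on
-- all of 𝔥*. Reversing coordinates turns the height coefficient 2n − 2j + 1 of εⱼ into 2j − 1,
-- and the two add up to 2n = ht δ; hence ht (w₀,ₙ w₀ x) = ht x − 2n (x | ωₙ). The translation
-- t_{ωₙ} adds exactly (x | ωₙ) δ, and its level-k terms cancel since ht ωₙ = ½ |ωₙ|² ht δ.
module Submission where

open import Defs
open import Data.Nat using (ℕ; _≤_)
open import Data.Fin using (Fin)
open import Data.Integer using (ℤ)
open import Relation.Binary.PropositionalEquality using (_≡_)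

import Data.Nat as ℕ
import Data.Nat.Properties as ℕ
import Data.Nat.Tactic.RingSolver as ℕ-Solver
open import Data.List using ([]; _∷_)
open import Data.Fin using (zero; suc; toℕ; opposite)
open import Data.Fin.Properties using (toℕ<n; opposite-prop; opposite-involutive)
import Data.Fin.Permutation as Perm
import Data.Integer as ℤ
import Data.Integer.Properties as ℤ
open import Data.Rational using (ℚ; _+_; _*_; _-_; -_; _/_; 1ℚ; ½)
open import Data.Rational.Properties
  using (normalize-coprime; +-*-commutativeRing; *-distribˡ-+; *-distribʳ-+; neg-distribʳ-*; +-comm)
open import Data.Rational.Solver using (module +-*-Solver)
open import Data.Nat.Coprimality using (1-coprimeTo) renaming (sym to coprime-sym)
open import Algebra.Bundles using (CommutativeRing)
import Algebra.Properties.Semiring.Sum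
open import Data.Product using (_,_)
open import Function using (_∘_)
open import Relation.Binary.PropositionalEquality using (refl; sym; trans; cong; cong₂; module ≡-Reasoning)
open ≡-Reasoning
open +-*-Solver

module Sum = Algebra.Properties.Semiring.Sum (CommutativeRing.semiring +-*-commutativeRing)

∑≡sum : ∀ {n} (f : Fin n → ℚ) → ∑ f ≡ Sum.sum f
∑≡sum {ℕ.zero}  f = refl
∑≡sum {ℕ.suc n} f = cong (f zero +_) (∑≡sum (f ∘ suc))

∑-cong : ∀ {n} {f g : Fin n → ℚ} → (∀ i → f i ≡ g i) → ∑ f ≡ ∑ g
∑-cong {f = f} {g} f≗g = trans (∑≡sum f) (trans (Sum.sum-cong-≗ f≗g) (sym (∑≡sum g)))

∑-distrib-+ : ∀ {n} (f g : Fin n → ℚ) → ∑ (λ i → f i + g i) ≡ ∑ f + ∑ g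
∑-distrib-+ f g = begin
  ∑ (λ i → f i + g i)          ≡⟨ ∑≡sum (λ i → f i + g i) ⟩
  Sum.sum (λ i → f i + g i)    ≡⟨ Sum.∑-distrib-+ f g ⟩
  Sum.sum f + Sum.sum g        ≡⟨ sym (cong₂ _+_ (∑≡sum f) (∑≡sum g)) ⟩
  ∑ f + ∑ g                    ∎

*-distribˡ-∑ : ∀ {n} (k : ℚ) (f : Fin n → ℚ) → k * ∑ f ≡ ∑ (λ i → k * f i)
*-distribˡ-∑ k f = begin
  k * ∑ f                      ≡⟨ cong (k *_) (∑≡sum f) ⟩
  k * Sum.sum f                ≡⟨ Sum.*-distribˡ-sum k f ⟩
  Sum.sum (λ i → k * f i)      ≡⟨ sym (∑≡sum (λ i → k * f i)) ⟩
  ∑ (λ i → k * f i)            ∎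

∑-reverse : ∀ {n} (f : Fin n → ℚ) → ∑ (f ∘ opposite) ≡ ∑ f
∑-reverse f = begin
  ∑ (f ∘ opposite)             ≡⟨ ∑≡sum (f ∘ opposite) ⟩
  Sum.sum (f ∘ opposite)       ≡⟨ sym (Sum.sum-permute f Perm.reverse) ⟩
  Sum.sum f                    ≡⟨ sym (∑≡sum f) ⟩
  ∑ f                          ∎

-‿distrib-∑ : ∀ {n} (f : Fin n → ℚ) → - ∑ f ≡ ∑ (λ i → - f i)
-‿distrib-∑ f = begin
  - ∑ f                        ≡⟨ solve 1 (λ s → :- s := (:- con 1ℚ) :* s) refl (∑ f) ⟩
  (- 1ℚ) * ∑ f                 ≡⟨ *-distribˡ-∑ (- 1ℚ) f ⟩
  ∑ (λ i → (- 1ℚ) * f i)       ≡⟨ ∑-cong (λ i → solve 1 (λ x → (:- con 1ℚ) :* x := :- x) refl (f i)) ⟩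
  ∑ (λ i → - f i)              ∎

fromℕ-+ : ∀ a b → fromℕ a + fromℕ b ≡ fromℕ (a ℕ.+ b)
fromℕ-+ a b
  rewrite normalize-coprime (coprime-sym (1-coprimeTo a))
        | normalize-coprime (coprime-sym (1-coprimeTo b))
  = cong₂ (λ x y → (x ℤ.+ y) / 1) (ℤ.*-identityʳ (ℤ.+ a)) (ℤ.*-identityʳ (ℤ.+ b))

2*suc∸1 : ∀ k → 2 ℕ.* ℕ.suc k ℕ.∸ 1 ≡ ℕ.suc (2 ℕ.* k)
2*suc∸1 k = ℕ.+-suc k (k ℕ.+ 0)

odd-pair-sum : ∀ n j → j ℕ.< n →
  (2 ℕ.* (n ℕ.∸ j) ℕ.∸ 1) ℕ.+ (2 ℕ.* (n ℕ.∸ (n ℕ.∸ ℕ.suc j)) ℕ.∸ 1) ≡ 2 ℕ.* n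
odd-pair-sum n j j<n with m , refl ← ℕ.m≤n⇒∃[o]m+o≡n j<n
  rewrite ℕ.m+n∸m≡n (ℕ.suc j) m | ℕ.+-∸-assoc 1 (ℕ.m≤m+n j m) | ℕ.m+n∸m≡n j m
        | ℕ.m+n∸n≡m (ℕ.suc j) m | 2*suc∸1 m | 2*suc∸1 j
  = ℕ-Solver.solve (j ∷ m ∷ [])

htδ : ℕ → ℚ
htδ n = fromℕ (2 ℕ.* n)

coeff : ∀ n → Fin n → ℚ
coeff n i = fromℕ (2 ℕ.* (n ℕ.∸ toℕ i) ℕ.∸ 1)

coeff-opposite : ∀ n (i : Fin n) → coeff n i + coeff n (opposite i) ≡ htδ n
coeff-opposite n i rewrite opposite-prop i =
  trans (fromℕ-+ (2 ℕ.* (n ℕ.∸ j) ℕ.∸ 1) (2 ℕ.* (n ℕ.∸ (n ℕ.∸ ℕ.suc j)) ℕ.∸ 1))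
        (cong fromℕ (odd-pair-sum n j (toℕ<n i)))
  where j = toℕ i

htV₀-⊕ : ∀ {n} (a b : V₀ n) → htV₀ (a ⊕ b) ≡ htV₀ a + htV₀ b
htV₀-⊕ {n} a b = begin
  htV₀ (a ⊕ b)                                   ≡⟨ ∑-cong (λ i → *-distribˡ-+ (coeff n i) (a i) (b i)) ⟩
  ∑ (λ i → coeff n i * a i + coeff n i * b i)    ≡⟨ ∑-distrib-+ (λ i → coeff n i * a i) (λ i → coeff n i * b i) ⟩
  htV₀ a + htV₀ b                                ∎

htV₀-⊙ : ∀ {n} (k : ℚ) (a : V₀ n) → htV₀ (k ⊙ a) ≡ k * htV₀ a
htV₀-⊙ {n} k a = begin
  htV₀ (k ⊙ a)                   ≡⟨ ∑-cong (λ i → solve 3 (λ c k x → c :* (k :* x) := k :* (c :* x)) refl (coeff n i) k (a i)) ⟩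
  ∑ (λ i → k * (coeff n i * a i)) ≡⟨ sym (*-distribˡ-∑ k (λ i → coeff n i * a i)) ⟩
  k * htV₀ a                     ∎

htV₀-w₀ : ∀ {n} (a : V₀ n) → htV₀ (w₀ a) ≡ - htV₀ a
htV₀-w₀ {n} a = begin
  htV₀ (w₀ a)                    ≡⟨ ∑-cong (λ i → sym (neg-distribʳ-* (coeff n i) (a i))) ⟩
  ∑ (λ i → - (coeff n i * a i))  ≡⟨ sym (-‿distrib-∑ (λ i → coeff n i * a i)) ⟩
  - htV₀ a                       ∎

htV₀-w₀ₙ : ∀ {n} (a : V₀ n) → htV₀ (w₀ₙ a) ≡ htδ n * ∑ a - htV₀ a
htV₀-w₀ₙ {n} a = begin
  htV₀ (w₀ₙ a)                         ≡⟨ solve 2 (λ x h → x := (x :+ h) :- h) refl (htV₀ (w₀ₙ a)) (htV₀ a) ⟩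
  (htV₀ (w₀ₙ a) + htV₀ a) - htV₀ a      ≡⟨ cong (_- htV₀ a) pair ⟩
  htδ n * ∑ a - htV₀ a                  ∎
  where
  c = coeff n
  reindex : htV₀ (w₀ₙ a) ≡ ∑ (λ i → c (opposite i) * a i)
  reindex = begin
    ∑ (λ i → c i * a (opposite i))                        ≡⟨ sym (∑-reverse (λ i → c i * a (opposite i))) ⟩
    ∑ (λ i → c (opposite i) * a (opposite (opposite i)))  ≡⟨ ∑-cong (λ i → cong (λ j → c (opposite i) * a j) (opposite-involutive i)) ⟩
    ∑ (λ i → c (opposite i) * a i)                        ∎
  pair : htV₀ (w₀ₙ a) + htV₀ a ≡ htδ n * ∑ a
  pair = begin
    htV₀ (w₀ₙ a) + htV₀ a                           ≡⟨ cong (_+ htV₀ a) reindex ⟩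
    ∑ (λ i → c (opposite i) * a i) + htV₀ a         ≡⟨ sym (∑-distrib-+ (λ i → c (opposite i) * a i) (λ i → c i * a i)) ⟩
    ∑ (λ i → c (opposite i) * a i + c i * a i)      ≡⟨ ∑-cong (λ i → sym (*-distribʳ-+ (a i) (c (opposite i)) (c i))) ⟩
    ∑ (λ i → (c (opposite i) + c i) * a i)          ≡⟨ ∑-cong (λ i → cong (_* a i) (trans (+-comm (c (opposite i)) (c i)) (coeff-opposite n i))) ⟩
    ∑ (λ i → htδ n * a i)                           ≡⟨ sym (*-distribˡ-∑ (htδ n) a) ⟩
    htδ n * ∑ a                                     ∎

⟪_∣ωₙ⟫ : ∀ {n} (a : V₀ n) → ⟪ a ∣ ωₙ ⟫ ≡ ∑ a
⟪ a ∣ωₙ⟫ = begin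
  fromℕ 2 * ∑ (λ j → a j * ½)     ≡⟨ *-distribˡ-∑ (fromℕ 2) (λ j → a j * ½) ⟩
  ∑ (λ j → fromℕ 2 * (a j * ½))   ≡⟨ ∑-cong (λ j → solve 1 (λ x → con (fromℕ 2) :* (x :* con ½) := x) refl (a j)) ⟩
  ∑ a                             ∎

htV₀-ωₙ : ∀ {n} → htV₀ {n} ωₙ ≡ ½ * (htδ n * ∑ {n} ωₙ)
htV₀-ωₙ {n} = begin
  h                         ≡⟨ solve 1 (λ h → h := con ½ :* (h :+ h)) refl h ⟩
  ½ * (h + h)               ≡⟨ cong (λ h′ → ½ * (h + h′)) (htV₀-w₀ₙ (ωₙ {n})) ⟩
  ½ * (h + (N * Σω - h))    ≡⟨ solve 3 (λ h N s → con ½ :* (h :+ (N :* s :- h)) := con ½ :* (N :* s)) refl h N Σω ⟩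
  ½ * (N * Σω)              ∎
  where
  h = htV₀ {n} ωₙ
  N = htδ n
  Σω = ∑ {n} ωₙ

ht-⊖ : ∀ {n} (u v : H* n) → ht (u ⊖ v) ≡ ht u - ht v
ht-⊖ {n} u v = begin
  htV₀ (fin u ⊕ w₀ (fin v)) + N * (dlt u - dlt v)
    ≡⟨ cong (_+ N * (dlt u - dlt v)) (trans (htV₀-⊕ (fin u) (w₀ (fin v))) (cong (htV₀ (fin u) +_) (htV₀-w₀ (fin v)))) ⟩
  (htV₀ (fin u) + - htV₀ (fin v)) + N * (dlt u - dlt v)
    ≡⟨ solve 5 (λ hu hv N du dv → (hu :+ :- hv) :+ N :* (du :- dv) := (hu :+ N :* du) :- (hv :+ N :* dv))
             refl (htV₀ (fin u)) (htV₀ (fin v)) N (dlt u) (dlt v) ⟩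
  ht u - ht v ∎
  where N = htδ n

ht-σₙ : ∀ {n} (v : H* n) → ht (σₙ v) ≡ ht v
ht-σₙ {n} ⟨ x , d , k ⟩ = begin
  htV₀ (w₀ₙ y ⊕ (k ⊙ ω)) + N * (d - (⟪ w₀ₙ y ∣ ω ⟫ + (½ * ∥ ω ∥²) * k))
    ≡⟨ cong₂ (λ h e → h + N * (d - e)) V₀-part δ-part ⟩
  ((N * ∑ y - - htV₀ x) + k * (½ * (N * Σω))) + N * (d - (∑ y + (½ * Σω) * k))
    ≡⟨ solve 6 (λ N s h k σ d →
         ((N :* s :- :- h) :+ k :* (con ½ :* (N :* σ))) :+ N :* (d :- (s :+ (con ½ :* σ) :* k)) := h :+ N :* d)
         refl N (∑ y) (htV₀ x) k Σω d ⟩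
  htV₀ x + N * d ∎
  where
  N = htδ n
  y = w₀ x
  ω = ωₙ {n}
  Σω = ∑ ω
  V₀-part : htV₀ (w₀ₙ y ⊕ (k ⊙ ω)) ≡ (N * ∑ y - - htV₀ x) + k * (½ * (N * Σω))
  V₀-part = trans (htV₀-⊕ (w₀ₙ y) (k ⊙ ω))
                  (cong₂ _+_ (trans (htV₀-w₀ₙ y) (cong (λ h → N * ∑ y - h) (htV₀-w₀ x)))
                             (trans (htV₀-⊙ k ω) (cong (k *_) (htV₀-ωₙ {n}))))
  δ-part : ⟪ w₀ₙ y ∣ ω ⟫ + (½ * ∥ ω ∥²) * k ≡ ∑ y + (½ * Σω) * k
  δ-part = cong₂ (λ s σ → s + (½ * σ) * k) (trans ⟪ w₀ₙ y ∣ωₙ⟫ (∑-reverse y)) ⟪ ω ∣ωₙ⟫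

L-σₙ : ∀ {n} (g : H* n → H* n) → L (σₙ ∘ g) ≡ L g
L-σₙ {n} g = begin
  ht (Λ₀ ⊖ σₙ (g Λ₀))            ≡⟨ ht-⊖ Λ₀ (σₙ (g Λ₀)) ⟩
  ht (Λ₀ {n}) - ht (σₙ (g Λ₀))    ≡⟨ cong (λ h → ht (Λ₀ {n}) - h) (ht-σₙ (g Λ₀)) ⟩
  ht (Λ₀ {n}) - ht (g Λ₀)         ≡⟨ sym (ht-⊖ Λ₀ (g Λ₀)) ⟩
  ht (Λ₀ ⊖ g Λ₀)                  ∎

theorem4p11 : (n : ℕ) → 2 ≤ n → (q : Fin n → ℤ) → (w : SignedPerm n) →
    L (λ v → σₙ (elt (embM q) w v)) ≡ L (elt (embM q) w)
theorem4p11 n _ q w = L-σₙ (elt (embM q) w)
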